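{- Let $T$ be a circle-tree and $x\in T$. If $\delta_T(x)=2$, then $T\setminus\{x\}$ is connected and is not a circle-tree. If $\delta_T(x)=3$, then $T\setminus\{x\}$ is not connected, and exactly one of its two connected components is a circle-tree.
   Context: All graphs are finite simple graphs; $T\setminus\{x\}$ denotes the induced subgraph on the remaining vertices; $\delta_T(x)$ is the degree of $x$ in $T$. A circle is a finite connected graph in which every vertex has degree exactly $2$. For disjoint graphs $G,H$ with $\Delta(G),\Delta(H)\le3$ and vertices $x\in G$, $y\in H$ of degree $2$ in their respective graphs, $G+_{x,y}H$ is the disjoint union of $G$ and $H$ with the single extra edge $\{x,y\}$. A finite graph $T$ is a circle-tree if there are circles $C(0),\dots,C(k-1)$ ($k\ge1$) and graphs $T(0)=C(0)$, $T(i)=T(i-1)+_{x,y}C(i)$ for $0<i<k$ (with $C(i)$ disjoint from $T(i-1)$, $x\in T(i-1)$ of degree $2$ in $T(i-1)$, $y\in C(i)$), such that $T=T(k-1)$. -}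

module Defs where

open import Data.Nat using (ℕ; _+_; _≤_; _<_)
open import Data.Bool using (Bool; true; false; not; _∧_; if_then_else_)
open import Data.Fin using (Fin; splitAt; _≟_)
open import Data.Sum using (_⊎_; inj₁; inj₂)
open import Data.Product using (Σ; _×_; _,_)
open import Data.List using (List; length; lookup; filterᵇ; allFin; map)
open import Data.Nat.ListAction using (sum)
open import Data.Empty using (⊥)
open import Relation.Nullary using (¬_)
open import Relation.Nullary.Decidable using (⌊_⌋)
open import Relation.Binary.PropositionalEquality using (_≡_; refl)
open import Function.Bundles using (_↔_; Inverse)

record Graph : Set where
  field
    n      : ℕ
    adj    : Fin n → Fin n → Bool
    sym    : ∀ u v → adj u v ≡ adj v u
    irrefl : ∀ u → adj u u ≡ false
open Graph public

deg : (G : Graph) → Fin (n G) → ℕ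
deg G v = sum (map (λ w → if adj G v w then 1 else 0) (allFin (n G)))

data Walk (G : Graph) : Fin (n G) → Fin (n G) → Set where
  here : ∀ {u} → Walk G u u
  step : ∀ {u v w} → adj G u v ≡ true → Walk G v w → Walk G u w

Connected : Graph → Set
Connected G = (0 < n G) × (∀ u v → Walk G u v)

IsCircle : Graph → Set
IsCircle G = Connected G × (∀ v → deg G v ≡ 2)

-- induced subgraph on the vertices satisfying a Boolean predicate P
-- (vertices enumerated in increasing order)
inducedVerts : (G : Graph) → (Fin (n G) → Bool) → List (Fin (n G))
inducedVerts G P = filterᵇ P (allFin (n G))

Induced : (G : Graph) → (Fin (n G) → Bool) → Graph
Induced G P = record
  { n      = length (inducedVerts G P)
  ; adj    = λ i j → adj G (lookup (inducedVerts G P) i) (lookup (inducedVerts G P) j)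
  ; sym    = λ i j → sym G (lookup (inducedVerts G P) i) (lookup (inducedVerts G P) j)
  ; irrefl = λ i → irrefl G (lookup (inducedVerts G P) i)
  }

delete : (G : Graph) → Fin (n G) → Graph
delete G x = Induced G (λ v → not ⌊ v ≟ x ⌋)

-- G +_{x,y} H : disjoint union plus the edge {x,y}
module _ {a b : ℕ} (adjG : Fin a → Fin a → Bool) (adjH : Fin b → Fin b → Bool)
         (x : Fin a) (y : Fin b) where
  sumAdj : Fin a ⊎ Fin b → Fin a ⊎ Fin b → Bool
  sumAdj (inj₁ u) (inj₁ v) = adjG u v
  sumAdj (inj₂ u) (inj₂ v) = adjH u v
  sumAdj (inj₁ u) (inj₂ v) = ⌊ u ≟ x ⌋ ∧ ⌊ v ≟ y ⌋
  sumAdj (inj₂ v) (inj₁ u) = ⌊ u ≟ x ⌋ ∧ ⌊ v ≟ y ⌋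

sumAdj-sym : (G H : Graph) (x : Fin (n G)) (y : Fin (n H)) →
  ∀ u v → sumAdj (adj G) (adj H) x y u v ≡ sumAdj (adj G) (adj H) x y v u
sumAdj-sym G H x y (inj₁ u) (inj₁ v) = sym G u v
sumAdj-sym G H x y (inj₂ u) (inj₂ v) = sym H u v
sumAdj-sym G H x y (inj₁ u) (inj₂ v) = refl
sumAdj-sym G H x y (inj₂ v) (inj₁ u) = refl

sumAdj-irrefl : (G H : Graph) (x : Fin (n G)) (y : Fin (n H)) →
  ∀ u → sumAdj (adj G) (adj H) x y u u ≡ false
sumAdj-irrefl G H x y (inj₁ u) = irrefl G u
sumAdj-irrefl G H x y (inj₂ u) = irrefl H u

join : (G H : Graph) → Fin (n G) → Fin (n H) → Graph
join G H x y = record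
  { n      = n G + n H
  ; adj    = λ u v → sumAdj (adj G) (adj H) x y (splitAt (n G) u) (splitAt (n G) v)
  ; sym    = λ u v → sumAdj-sym G H x y (splitAt (n G) u) (splitAt (n G) v)
  ; irrefl = λ u → sumAdj-irrefl G H x y (splitAt (n G) u)
  }

-- graphs built by the circle-tree construction T(0) = C(0), T(i) = T(i-1) +_{x,y} C(i)
data BuildsCircleTree : Graph → Set where
  base : ∀ {C} → IsCircle C → BuildsCircleTree C
  glue : ∀ {G C} → BuildsCircleTree G → IsCircle C →
         (x : Fin (n G)) (y : Fin (n C)) →
         (∀ v → deg G v ≤ 3) → deg G x ≡ 2 → deg C y ≡ 2 →
         BuildsCircleTree (join G C x y)

record Iso (G H : Graph) : Set where
  field
    bij      : Fin (n G) ↔ Fin (n H)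
    preserve : ∀ u v → adj G u v ≡ adj H (Inverse.to bij u) (Inverse.to bij v)

IsCircleTree : Graph → Set
IsCircleTree T = Σ Graph (λ G → BuildsCircleTree G × Iso G T)

TwoComponentsExactlyOneCircleTree : Graph → Set
TwoComponentsExactlyOneCircleTree G =
  Σ (Fin (n G) → Bool) λ c →
    Connected (Induced G c) × Connected (Induced G (λ v → not (c v))) ×
    (∀ u v → adj G u v ≡ true → c u ≡ c v) ×
    ((IsCircleTree (Induced G c) × ¬ IsCircleTree (Induced G (λ v → not (c v))))
     ⊎ (¬ IsCircleTree (Induced G c) × IsCircleTree (Induced G (λ v → not (c v)))))

{-# OPTIONS --safe #-}
-- Every vertex of a circle-tree lies on its own circle, and the construction glues circles along
-- bridges, so its structural properties follow by induction on the construction.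
-- Deleting a vertex x of degree 2 keeps T connected: on its circle, the two neighbours of x stay
-- joined, since otherwise the component of one of them in C − x would contain exactly one
-- neighbour of x, which the handshake lemma forbids in a 2-regular graph. But the circle through x is
-- broken, leaving one of its vertices on no cycle, so T − x is not a circle-tree.
-- A vertex x of degree 3 is the end of a bridge, so T is the gluing A +_{x,b} B of two
-- circle-trees, where x has degree 2 in A. Hence T − x falls apart into B, a circle-tree, and
-- A − x, which by the degree-2 case is connected and not a circle-tree.
module Submission where

open import Defs
open import Data.Nat using (ℕ)
open import Data.Fin using (Fin)
open import Data.Product using (_×_)
open import Relation.Nullary using (¬_)
open import Relation.Binary.PropositionalEquality using (_≡_)

open import Data.Bool using (Bool; true; false; not; _∧_; _∨_; if_then_else_)
open import Data.Bool.Properties using (∧-zeroʳ; ∧-identityʳ; ∧-comm; ∨-zeroʳ; not-involutive; T-≡)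
open import Data.Empty using (⊥; ⊥-elim)
open import Data.Fin using (zero; suc; _↑ˡ_; _↑ʳ_; splitAt; _≟_)
import Data.Fin.Properties as Fin
open import Data.Fin.Properties
  using (any?; splitAt-↑ˡ; splitAt-↑ʳ; splitAt⁻¹-↑ˡ; splitAt⁻¹-↑ʳ; ↑ˡ-injective; ↑ʳ-injective)
open import Data.List using (List; allFin; tabulate; lookup)
open import Data.List.Properties using (map-tabulate)
open import Data.List.Membership.Propositional.Properties using (∈-lookup; ∈-allFin; ∈-filter⁺; ∈-filter⁻)
open import Data.List.Relation.Unary.All as All using (All)
open import Data.List.Relation.Unary.AllPairs using (_∷_)
open import Data.List.Relation.Unary.Any using (index)
open import Data.List.Relation.Unary.Any.Properties using (lookup-index)
open import Data.List.Relation.Unary.Unique.Propositional using (Unique)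
open import Data.List.Relation.Unary.Unique.Propositional.Properties using (filter⁺; allFin⁺)
open import Data.Nat using (zero; suc; _+_; _*_; _≤_; _<_; z≤n; s≤s)
import Data.Nat.ListAction as List
open import Data.Nat.Properties
  using (+-0-commutativeMonoid; +-*-semiring; *-comm; +-identityʳ; +-assoc; suc-injective;
         ≤-refl; ≤-trans; n≤1+n; m≤n+m; m≤m+n; <⇒≱; even≢odd)
open import Data.Nat.Tactic.RingSolver using (solve-∀)
open import Algebra.Properties.CommutativeMonoid.Sum +-0-commutativeMonoid
  using (sum; sum-syntax; sum-cong-≗; ∑-distrib-+; ∑-permute)
open import Algebra.Properties.Semiring.Sum +-*-semiring using (*-distribʳ-sum)
open import Data.Product using (Σ-syntax; ∃-syntax; _,_; proj₁; proj₂)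
open import Data.Sum using (_⊎_; inj₁; inj₂; [_,_]′)
open import Data.Unit using (⊤; tt)
open import Function using (_∘_; id)
open import Function.Bundles using (Equivalence; Inverse; mk↔ₛ′)
open import Relation.Binary.PropositionalEquality
  using (_≢_; refl; trans; cong; cong₂; module ≡-Reasoning)
  renaming (sym to ≡-sym)
open import Relation.Nullary using (yes; no)
open import Relation.Nullary.Decidable using (⌊_⌋; T?; toWitness; fromWitness)

≟-refl : ∀ {m} (u : Fin m) → ⌊ u ≟ u ⌋ ≡ true
≟-refl u with u ≟ u
... | yes _   = refl
... | no u≢u = ⊥-elim (u≢u refl)

≟-≢ : ∀ {m} {u v : Fin m} → u ≢ v → ⌊ u ≟ v ⌋ ≡ false
≟-≢ {u = u} {v} u≢v with u ≟ v
... | yes u≡v = ⊥-elim (u≢v u≡v)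
... | no _    = refl

≟-true : ∀ {m} {u v : Fin m} → ⌊ u ≟ v ⌋ ≡ true → u ≡ v
≟-true {u = u} {v} eq with u ≟ v
... | yes u≡v = u≡v

≟-injective : ∀ {m k} (f : Fin m → Fin k) → (∀ {u v} → f u ≡ f v → u ≡ v) →
  ∀ u v → ⌊ f u ≟ f v ⌋ ≡ ⌊ u ≟ v ⌋
≟-injective f f-inj u v with u ≟ v
... | yes refl = ≟-refl (f u)
... | no u≢v   = ≟-≢ (u≢v ∘ f-inj)

≢⇒≟-false : ∀ {m} {u v : Fin m} → u ≢ v → not ⌊ u ≟ v ⌋ ≡ true
≢⇒≟-false u≢v = cong not (≟-≢ u≢v)

≟-false⇒≢ : ∀ {m} {u v : Fin m} → not ⌊ u ≟ v ⌋ ≡ true → u ≢ v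
≟-false⇒≢ {u = u} u≠v refl with trans (≡-sym u≠v) (cong not (≟-refl u))
... | ()

∧-true : ∀ {a b} → a ∧ b ≡ true → a ≡ true × b ≡ true
∧-true {true} {true} _ = refl , refl

false≢true : false ≢ true
false≢true ()

≡2⇒+1≢2 : ∀ {d} → d ≡ 2 → d + 1 ≢ 2
≡2⇒+1≢2 refl ()

double≢odd : ∀ c e → c * 2 ≢ (e + e) + 1
double≢odd c e eq = even≢odd c e (trans (*-comm 2 c) (trans eq (rearrange e)))
  where
  rearrange : ∀ e → (e + e) + 1 ≡ suc (2 * e)
  rearrange = solve-∀

χ : Bool → ℕ
χ b = if b then 1 else 0

count : ∀ {m} → (Fin m → Bool) → ℕ
count {m} f = ∑[ i < m ] χ (f i)

∑-zero : ∀ {m} (f : Fin m → ℕ) → (∀ i → f i ≡ 0) → sum f ≡ 0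
∑-zero {zero}  f f≡0 = refl
∑-zero {suc m} f f≡0 = cong₂ _+_ (f≡0 zero) (∑-zero (f ∘ suc) (f≡0 ∘ suc))

∑-single : ∀ {m} (f : Fin m → ℕ) v → (∀ w → w ≢ v → f w ≡ 0) → sum f ≡ f v
∑-single {suc m} f zero    f≡0 =
  trans (cong (f zero +_) (∑-zero (f ∘ suc) (λ i → f≡0 (suc i) (λ ())))) (+-identityʳ _)
∑-single {suc m} f (suc v) f≡0 =
  cong₂ _+_ (f≡0 zero (λ ())) (∑-single (f ∘ suc) v (λ w w≢v → f≡0 (suc w) (w≢v ∘ Fin.suc-injective)))

∑-↑ : ∀ a b (f : Fin (a + b) → ℕ) → sum f ≡ ∑[ i < a ] f (i ↑ˡ b) + ∑[ j < b ] f (a ↑ʳ j)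
∑-↑ zero    b f = refl
∑-↑ (suc a) b f = trans (cong (f zero +_) (∑-↑ a b (f ∘ suc))) (≡-sym (+-assoc (f zero) _ _))

_⊆ᵇ_ : ∀ {m} → (Fin m → Bool) → (Fin m → Bool) → Set
R ⊆ᵇ R′ = ∀ {u} → R u ≡ true → R′ u ≡ true

count-≤ : ∀ {m} (R : Fin m → Bool) → count R ≤ m
count-≤ {zero}  R = z≤n
count-≤ {suc m} R with R zero
... | true  = s≤s (count-≤ (R ∘ suc))
... | false = ≤-trans (count-≤ (R ∘ suc)) (n≤1+n _)

count-mono : ∀ {m} {R R′ : Fin m → Bool} → R ⊆ᵇ R′ → count R ≤ count R′
count-mono {zero}  R⊆R′ = z≤n
count-mono {suc m} {R} {R′} R⊆R′ with R zero in r | R′ zero in r′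
... | true  | true  = s≤s (count-mono {R = R ∘ suc} {R′ ∘ suc} R⊆R′)
... | false | true  = ≤-trans (count-mono {R = R ∘ suc} {R′ ∘ suc} R⊆R′) (n≤1+n _)
... | false | false = count-mono {R = R ∘ suc} {R′ ∘ suc} R⊆R′
... | true  | false with trans (≡-sym (R⊆R′ r)) r′
...   | ()

count-positive : ∀ {m} (R : Fin m → Bool) {u} → R u ≡ true → 1 ≤ count R
count-positive R {zero}  Ru rewrite Ru = s≤s z≤n
count-positive R {suc u} Ru = ≤-trans (count-positive (R ∘ suc) Ru) (m≤n+m _ _)

count-strict : ∀ {m} {R R′ : Fin m → Bool} → R ⊆ᵇ R′ → (∀ u → R′ u ≡ R u) ⊎ count R < count R′
count-strict {zero}  R⊆R′ = inj₁ (λ ())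
count-strict {suc m} {R} {R′} R⊆R′ with R zero in r | R′ zero in r′ | count-strict {R = R ∘ suc} {R′ ∘ suc} R⊆R′
... | true  | true  | inj₁ same = inj₁ λ { zero → trans r′ (≡-sym r) ; (suc u) → same u }
... | true  | true  | inj₂ less = inj₂ (s≤s less)
... | false | false | inj₁ same = inj₁ λ { zero → trans r′ (≡-sym r) ; (suc u) → same u }
... | false | false | inj₂ less = inj₂ less
... | false | true  | _ = inj₂ (s≤s (count-mono {R = R ∘ suc} {R′ ∘ suc} R⊆R′))
... | true  | false | _ with trans (≡-sym (R⊆R′ r)) r′
...   | ()

count≡0⇒false : ∀ {m} (f : Fin m → Bool) → count f ≡ 0 → ∀ w → f w ≡ false
count≡0⇒false {suc m} f c≡0 w with f zero in f0
count≡0⇒false {suc m} f c≡0 zero    | false = f0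
count≡0⇒false {suc m} f c≡0 (suc w) | false = count≡0⇒false (f ∘ suc) c≡0 w

count≡1⇒unique : ∀ {m} (f : Fin m → Bool) → count f ≡ 1 →
  ∃[ a ] f a ≡ true × (∀ w → f w ≡ true → w ≡ a)
count≡1⇒unique {suc m} f c≡1 with f zero in f0
... | true = zero , f0 , only-zero
  where
  only-zero : ∀ w → f w ≡ true → w ≡ zero
  only-zero zero    _   = refl
  only-zero (suc w) fw with trans (≡-sym fw) (count≡0⇒false (f ∘ suc) (suc-injective c≡1) w)
  ... | ()
... | false with count≡1⇒unique (f ∘ suc) c≡1
... | a , fa , only-a = suc a , fa ,
      λ { zero fw → ⊥-elim (false≢true (trans (≡-sym f0) fw)) ; (suc w) fw → cong suc (only-a w fw) }

count≡2⇒pair : ∀ {m} (f : Fin m → Bool) → count f ≡ 2 →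
  ∃[ a ] ∃[ b ] a ≢ b × f a ≡ true × f b ≡ true × (∀ w → f w ≡ true → w ≡ a ⊎ w ≡ b)
count≡2⇒pair {suc m} f c≡2 with f zero in f0
... | true with count≡1⇒unique (f ∘ suc) (suc-injective c≡2)
...   | b , fb , only-b = zero , suc b , (λ ()) , f0 , fb ,
        λ { zero _ → inj₁ refl ; (suc w) fw → inj₂ (cong suc (only-b w fw)) }
count≡2⇒pair {suc m} f c≡2 | false with count≡2⇒pair (f ∘ suc) c≡2
... | a , b , a≢b , fa , fb , only-ab = suc a , suc b , a≢b ∘ Fin.suc-injective , fa , fb ,
      λ { zero fw → ⊥-elim (false≢true (trans (≡-sym f0) fw))
        ; (suc w) fw → Data.Sum.map (cong suc) (cong suc) (only-ab w fw) }

handshake-even : ∀ {m} (M : Fin m → Fin m → Bool) → (∀ u w → M u w ≡ M w u) → (∀ u → M u u ≡ false) →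
  ∃[ e ] ∑[ u < m ] count (M u) ≡ e + e
handshake-even {zero}  M M-sym M-irrefl = 0 , refl
handshake-even {suc m} M M-sym M-irrefl
  with handshake-even (λ u w → M (suc u) (suc w)) (λ u w → M-sym (suc u) (suc w)) (M-irrefl ∘ suc)
... | e , rest≡e+e = d + e , (begin
    count (M zero) + ∑[ u < m ] count (M (suc u))
      ≡⟨ cong₂ _+_ (cong (λ b → χ b + d) (M-irrefl zero)) (∑-distrib-+ (λ u → χ (M (suc u) zero)) _) ⟩
    d + (∑[ u < m ] χ (M (suc u) zero) + ∑[ u < m ] count (λ w → M (suc u) (suc w)))
      ≡⟨ cong₂ (λ p q → d + (p + q)) (sum-cong-≗ (λ u → cong χ (M-sym (suc u) zero))) rest≡e+e ⟩
    d + (d + (e + e))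
      ≡⟨ regroup d e ⟩
    (d + e) + (d + e) ∎)
  where
  open ≡-Reasoning
  d = count (λ w → M zero (suc w))
  regroup : ∀ d e → d + (d + (e + e)) ≡ (d + e) + (d + e)
  regroup = solve-∀

deg≡count : ∀ G v → deg G v ≡ count (adj G v)
deg≡count G v = trans (cong List.sum (map-tabulate id (χ ∘ adj G v))) (sum-tabulate (χ ∘ adj G v))
  where
  sum-tabulate : ∀ {m} (f : Fin m → ℕ) → List.sum (tabulate f) ≡ sum f
  sum-tabulate {zero}  f = refl
  sum-tabulate {suc m} f = cong (f zero +_) (sum-tabulate (f ∘ suc))

adj⇒≢ : ∀ G {u v} → adj G u v ≡ true → u ≢ v
adj⇒≢ G {u} uv refl with trans (≡-sym uv) (irrefl G u)
... | ()

adj-sym : ∀ G {u v} → adj G u v ≡ true → adj G v u ≡ true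
adj-sym G {u} {v} uv = trans (Graph.sym G v u) uv

deg≡2⇒neighbours : ∀ G v → deg G v ≡ 2 →
  ∃[ a ] ∃[ b ] a ≢ b × adj G v a ≡ true × adj G v b ≡ true × (∀ w → adj G v w ≡ true → w ≡ a ⊎ w ≡ b)
deg≡2⇒neighbours G v d = count≡2⇒pair (adj G v) (trans (≡-sym (deg≡count G v)) d)

walk-invariant : ∀ {G} {A : Set} (c : Fin (n G) → A) → (∀ u v → adj G u v ≡ true → c u ≡ c v) →
  ∀ {u v} → Walk G u v → c u ≡ c v
walk-invariant c resp here       = refl
walk-invariant c resp (step e w) = trans (resp _ _ e) (walk-invariant c resp w)

record Embedding (G H : Graph) : Set where
  field
    vertex     : Fin (n G) → Fin (n H)
    injective  : ∀ {u v} → vertex u ≡ vertex v → u ≡ v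
    adj-vertex : ∀ u v → adj H (vertex u) (vertex v) ≡ adj G u v

  adj-true : ∀ {u v} → adj G u v ≡ true → adj H (vertex u) (vertex v) ≡ true
  adj-true {u} {v} uv = trans (adj-vertex u v) uv

  InImage : Fin (n H) → Set
  InImage t = ∃[ u ] vertex u ≡ t

open Embedding public using (vertex; InImage)

_∘ᵉ_ : ∀ {G H K} → Embedding H K → Embedding G H → Embedding G K
f ∘ᵉ g = record
  { vertex     = vertex f ∘ vertex g
  ; injective  = Embedding.injective g ∘ Embedding.injective f
  ; adj-vertex = λ u v → trans (Embedding.adj-vertex f _ _) (Embedding.adj-vertex g u v)
  }

module _ {G H : Graph} (I : Iso G H) where
  open Inverse (Iso.bij I)

  iso-embedding : Embedding G H
  iso-embedding = record
    { vertex     = to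
    ; injective  = λ {u} {v} eq → trans (≡-sym (strictlyInverseʳ u)) (trans (cong from eq) (strictlyInverseʳ v))
    ; adj-vertex = λ u v → ≡-sym (Iso.preserve I u v)
    }

  iso-surjective : ∀ t → InImage iso-embedding t
  iso-surjective t = from t , strictlyInverseˡ t

  iso-deg : ∀ u → deg H (to u) ≡ deg G u
  iso-deg u = begin
    deg H (to u)                      ≡⟨ deg≡count H (to u) ⟩
    count (adj H (to u))              ≡⟨ ∑-permute (χ ∘ adj H (to u)) (Iso.bij I) ⟩
    ∑[ w < n G ] χ (adj H (to u) (to w)) ≡⟨ sum-cong-≗ (λ w → cong χ (≡-sym (Iso.preserve I u w))) ⟩
    count (adj G u)                   ≡⟨ deg≡count G u ⟨
    deg G u                           ∎
    where open ≡-Reasoning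

surjective-iso : ∀ {G H} (e : Embedding G H) → (∀ t → InImage e t) → Iso G H
surjective-iso {G} {H} e onto = record
  { bij      = mk↔ₛ′ (vertex e) (proj₁ ∘ onto) (proj₂ ∘ onto)
                     (λ u → Embedding.injective e (proj₂ (onto (vertex e u))))
  ; preserve = λ u v → ≡-sym (Embedding.adj-vertex e u v)
  }

iso-refl : ∀ {G} → Iso G G
iso-refl = surjective-iso (record { vertex = id ; injective = id ; adj-vertex = λ _ _ → refl }) (_, refl)

iso-sym : ∀ {G H} → Iso G H → Iso H G
iso-sym {G} {H} I = surjective-iso from-embedding (λ u → to u , strictlyInverseʳ u)
  where
  open Inverse (Iso.bij I)
  from-embedding : Embedding H G
  from-embedding = record
    { vertex     = from
    ; injective  = λ {u} {v} eq → trans (≡-sym (strictlyInverseˡ u)) (trans (cong to eq) (strictlyInverseˡ v))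
    ; adj-vertex = λ u v → trans (Iso.preserve I (from u) (from v)) (cong₂ (adj H) (strictlyInverseˡ u) (strictlyInverseˡ v))
    }

iso-trans : ∀ {G H K} → Iso G H → Iso H K → Iso G K
iso-trans I J = surjective-iso (iso-embedding J ∘ᵉ iso-embedding I) onto
  where
  onto : ∀ t → InImage (iso-embedding J ∘ᵉ iso-embedding I) t
  onto t with iso-surjective J t
  ... | s , refl with iso-surjective I s
  ...   | u , refl = u , refl

circleTree-iso : ∀ {G H} → IsCircleTree G → Iso G H → IsCircleTree H
circleTree-iso (K , bK , I) J = K , bK , iso-trans I J

data WalkWithin (G : Graph) (Q : Fin (n G) → Set) : Fin (n G) → Fin (n G) → Set where
  stop : ∀ {u} → Q u → WalkWithin G Q u u
  move : ∀ {u v w} → Q u → adj G u v ≡ true → WalkWithin G Q v w → WalkWithin G Q u w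

module _ {G : Graph} {Q : Fin (n G) → Set} where
  source-within : ∀ {u v} → WalkWithin G Q u v → Q u
  source-within (stop q)     = q
  source-within (move q _ _) = q

  target-within : ∀ {u v} → WalkWithin G Q u v → Q v
  target-within (stop q)     = q
  target-within (move _ _ w) = target-within w

  _++ʷ_ : ∀ {u v w} → WalkWithin G Q u v → WalkWithin G Q v w → WalkWithin G Q u w
  stop _     ++ʷ w′ = w′
  move q e w ++ʷ w′ = move q e (w ++ʷ w′)

  snocʷ : ∀ {u v w} → WalkWithin G Q u v → adj G v w ≡ true → Q w → WalkWithin G Q u w
  snocʷ w e q = w ++ʷ move (target-within w) e (stop q)

  reverseʷ : ∀ {u v} → WalkWithin G Q u v → WalkWithin G Q v u
  reverseʷ (stop q)     = stop q
  reverseʷ (move q e w) = snocʷ (reverseʷ w) (adj-sym G e) q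

  weakenʷ : ∀ {Q′ : Fin (n G) → Set} → (∀ {u} → Q u → Q′ u) →
    ∀ {u v} → WalkWithin G Q u v → WalkWithin G Q′ u v
  weakenʷ h (stop q)     = stop (h q)
  weakenʷ h (move q e w) = move (h q) e (weakenʷ h w)

  toWalk : ∀ {u v} → WalkWithin G Q u v → Walk G u v
  toWalk (stop _)     = here
  toWalk (move _ e w) = step e (toWalk w)

fromWalk : ∀ {G u v} → Walk G u v → WalkWithin G (λ _ → ⊤) u v
fromWalk here       = stop tt
fromWalk (step e w) = move tt e (fromWalk w)

ConnectedWithin : (G : Graph) → (Fin (n G) → Set) → Set
ConnectedWithin G Q = ∀ u v → Q u → Q v → WalkWithin G Q u v

module _ {G H : Graph} (f : Embedding G H) where
  open Embedding f hiding (vertex; InImage)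

  mapʷ : ∀ {Q Q′} → (∀ {u} → Q u → Q′ (vertex f u)) → ∀ {u v} →
    WalkWithin G Q u v → WalkWithin H Q′ (vertex f u) (vertex f v)
  mapʷ h (stop q)     = stop (h q)
  mapʷ h (move q e w) = move (h q) (adj-true e) (mapʷ h w)

  pullʷ : ∀ {Q} → (∀ {t} → Q t → InImage f t) → ∀ {u v} →
    WalkWithin H Q (vertex f u) (vertex f v) → WalkWithin G (Q ∘ vertex f) u v
  pullʷ {Q} onto = go refl refl
    where
    go : ∀ {s t u v} → vertex f u ≡ s → vertex f v ≡ t → WalkWithin H Q s t → WalkWithin G (Q ∘ vertex f) u v
    go refl fv≡t (stop q) rewrite injective fv≡t = stop q
    go {u = u} refl fv≡t (move q e w) with onto (source-within w)
    ... | k , refl = move q (trans (≡-sym (adj-vertex u k)) e) (go refl fv≡t w)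

lookup-injective : ∀ {A : Set} {xs : List A} → Unique xs → ∀ {i j} → lookup xs i ≡ lookup xs j → i ≡ j
lookup-injective (_ ∷ _)  {zero}  {zero}  _  = refl
lookup-injective (x∉ ∷ _) {zero}  {suc j} eq = ⊥-elim (All.lookup x∉ (∈-lookup j) eq)
lookup-injective (x∉ ∷ _) {suc i} {zero}  eq = ⊥-elim (All.lookup x∉ (∈-lookup i) (≡-sym eq))
lookup-injective (_ ∷ u)  {suc i} {suc j} eq = cong suc (lookup-injective u eq)

module _ (G : Graph) (P : Fin (n G) → Bool) where

  induced-embedding : Embedding (Induced G P) G
  induced-embedding = record
    { vertex     = lookup (inducedVerts G P)
    ; injective  = lookup-injective (filter⁺ (T? ∘ P) (allFin⁺ (n G)))
    ; adj-vertex = λ _ _ → refl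
    }

  induced-holds : ∀ i → P (vertex induced-embedding i) ≡ true
  induced-holds i = Equivalence.to T-≡ (proj₂ (∈-filter⁻ (T? ∘ P) {xs = allFin (n G)} (∈-lookup i)))

  induced-onto : ∀ {u} → P u ≡ true → InImage induced-embedding u
  induced-onto {u} Pu = index u∈ , ≡-sym (lookup-index u∈)
    where u∈ = ∈-filter⁺ (T? ∘ P) (∈-allFin u) (Equivalence.from T-≡ Pu)

  module _ {K : Graph} (e : Embedding K G) (P∘e : ∀ k → P (vertex e k) ≡ true) where
    private
      ℓ = induced-embedding

    restrict-vertex : ∀ k → vertex ℓ (proj₁ (induced-onto (P∘e k))) ≡ vertex e k
    restrict-vertex k = proj₂ (induced-onto (P∘e k))

    restrict : Embedding K (Induced G P)
    restrict = record
      { vertex     = λ k → proj₁ (induced-onto (P∘e k))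
      ; injective  = λ eq → Embedding.injective e
                       (trans (≡-sym (restrict-vertex _)) (trans (cong (vertex ℓ) eq) (restrict-vertex _)))
      ; adj-vertex = λ k k′ → trans (cong₂ (adj G) (restrict-vertex k) (restrict-vertex k′)) (Embedding.adj-vertex e k k′)
      }

    restrict-onto : ∀ {i} → InImage e (vertex ℓ i) → InImage restrict i
    restrict-onto (k , ek≡ℓi) = k , Embedding.injective ℓ (trans (restrict-vertex k) ek≡ℓi)

    induced-iso : (∀ {u} → P u ≡ true → InImage e u) → Iso K (Induced G P)
    induced-iso onto = surjective-iso restrict (λ i → restrict-onto (onto (induced-holds i)))

OnCycleWithin : (G : Graph) → (Fin (n G) → Set) → Fin (n G) → Set
OnCycleWithin G Q w = ∃[ a ] ∃[ b ] a ≢ b × adj G w a ≡ true × adj G w b ≡ true ×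
  WalkWithin G (λ z → Q z × z ≢ w) a b

OnCycle : (G : Graph) → Fin (n G) → Set
OnCycle G = OnCycleWithin G (λ _ → ⊤)

onCycle-weaken : ∀ {G Q Q′ w} → (∀ {u} → Q u → Q′ u) → OnCycleWithin G Q w → OnCycleWithin G Q′ w
onCycle-weaken h (a , b , a≢b , wa , wb , walk) = a , b , a≢b , wa , wb , weakenʷ (Data.Product.map₁ h) walk

module _ {G H : Graph} (f : Embedding G H) where
  open Embedding f using (injective; adj-true; adj-vertex)

  onCycle-map : ∀ {Q Q′ w} → (∀ {u} → Q u → Q′ (vertex f u)) →
    OnCycleWithin G Q w → OnCycleWithin H Q′ (vertex f w)
  onCycle-map h (a , b , a≢b , wa , wb , walk) =
    vertex f a , vertex f b , a≢b ∘ injective , adj-true wa , adj-true wb ,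
    mapʷ f (λ (q , z≢w) → h q , z≢w ∘ injective) walk

  onCycle-pull : ∀ {Q w} → (∀ {t} → Q t → InImage f t) →
    OnCycleWithin H Q (vertex f w) → OnCycleWithin G (Q ∘ vertex f) w
  onCycle-pull {Q} {w} onto (a , b , a≢b , wa , wb , walk)
    with onto (proj₁ (source-within walk)) | onto (proj₁ (target-within walk))
  ... | a′ , refl | b′ , refl =
    a′ , b′ , (λ { refl → a≢b refl }) , trans (≡-sym (adj-vertex w a′)) wa , trans (≡-sym (adj-vertex w b′)) wb ,
    weakenʷ (λ (q , z≢w) → q , λ { refl → z≢w refl }) (pullʷ f (onto ∘ proj₁) walk)

fin⇒nonempty : ∀ {m} → Fin m → 0 < m
fin⇒nonempty {suc m} _ = s≤s z≤n

induced-connected : ∀ G P → ConnectedWithin G (λ u → P u ≡ true) → ∀ {u} → P u ≡ true → Connected (Induced G P)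
induced-connected G P conn Pu =
  fin⇒nonempty (proj₁ (induced-onto G P Pu)) ,
  λ i j → toWalk (pullʷ ℓ (induced-onto G P) (conn (vertex ℓ i) (vertex ℓ j) (induced-holds G P i) (induced-holds G P j)))
  where ℓ = induced-embedding G P

iso-connected : ∀ {G H} → Iso G H → Connected G → Connected H
iso-connected {G} {H} I (0<n , conn) = fin⇒nonempty (vertex f (Data.Fin.fromℕ< 0<n)) , walk
  where
  f = iso-embedding I
  walk : ∀ u v → Walk H u v
  walk u v with iso-surjective I u | iso-surjective I v
  ... | u′ , refl | v′ , refl = toWalk (mapʷ f {Q′ = λ _ → ⊤} _ (fromWalk (conn u′ v′)))

-- Joining two graphs by an edge

module Join (G H : Graph) (x : Fin (n G)) (y : Fin (n H)) where
  J : Graph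
  J = join G H x y

  inl : Fin (n G) → Fin (n J)
  inl u = u ↑ˡ n H

  inr : Fin (n H) → Fin (n J)
  inr v = n G ↑ʳ v

  data View : Fin (n J) → Set where
    isl : ∀ u → View (inl u)
    isr : ∀ v → View (inr v)

  view : ∀ w → View w
  view w with splitAt (n G) w in eq
  ... | inj₁ u rewrite ≡-sym (splitAt⁻¹-↑ˡ eq) = isl u
  ... | inj₂ v rewrite ≡-sym (splitAt⁻¹-↑ʳ eq) = isr v

  inl≢inr : ∀ {u v} → inl u ≢ inr v
  inl≢inr {u} {v} eq
    with trans (≡-sym (splitAt-↑ˡ (n G) u (n H))) (trans (cong (splitAt (n G)) eq) (splitAt-↑ʳ (n G) (n H) v))
  ... | ()

  inl-embedding : Embedding G J
  inl-embedding = record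
    { vertex     = inl
    ; injective  = ↑ˡ-injective (n H) _ _
    ; adj-vertex = λ u u′ → cong₂ (sumAdj (adj G) (adj H) x y) (splitAt-↑ˡ (n G) u (n H)) (splitAt-↑ˡ (n G) u′ (n H))
    }

  inr-embedding : Embedding H J
  inr-embedding = record
    { vertex     = inr
    ; injective  = ↑ʳ-injective (n G) _ _
    ; adj-vertex = λ v v′ → cong₂ (sumAdj (adj G) (adj H) x y) (splitAt-↑ʳ (n G) (n H) v) (splitAt-↑ʳ (n G) (n H) v′)
    }

  adj-inl-inr : ∀ u v → adj J (inl u) (inr v) ≡ ⌊ u ≟ x ⌋ ∧ ⌊ v ≟ y ⌋
  adj-inl-inr u v = cong₂ (sumAdj (adj G) (adj H) x y) (splitAt-↑ˡ (n G) u (n H)) (splitAt-↑ʳ (n G) (n H) v)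

  bridge : ∀ {u v} → adj J (inl u) (inr v) ≡ true → u ≡ x × v ≡ y
  bridge {u} {v} uv = Data.Product.map ≟-true ≟-true (∧-true (trans (≡-sym (adj-inl-inr u v)) uv))

  bridge-adj : adj J (inl x) (inr y) ≡ true
  bridge-adj = trans (adj-inl-inr x y) (cong₂ _∧_ (≟-refl x) (≟-refl y))

  deg-inl : ∀ u → deg J (inl u) ≡ deg G u + χ ⌊ u ≟ x ⌋
  deg-inl u = begin
    deg J (inl u)                                               ≡⟨ deg≡count J (inl u) ⟩
    count (adj J (inl u))                                       ≡⟨ ∑-↑ (n G) (n H) _ ⟩
    ∑[ w < n G ] χ (adj J (inl u) (inl w)) + ∑[ w < n H ] χ (adj J (inl u) (inr w))
      ≡⟨ cong₂ _+_ (sum-cong-≗ (cong χ ∘ Embedding.adj-vertex inl-embedding u))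
                   (sum-cong-≗ (cong χ ∘ adj-inl-inr u)) ⟩
    count (adj G u) + ∑[ w < n H ] χ (⌊ u ≟ x ⌋ ∧ ⌊ w ≟ y ⌋)
      ≡⟨ cong₂ _+_ (≡-sym (deg≡count G u))
                   (∑-single _ y (λ w w≢y → trans (cong (λ b → χ (⌊ u ≟ x ⌋ ∧ b)) (≟-≢ w≢y)) (cong χ (∧-zeroʳ _)))) ⟩
    deg G u + χ (⌊ u ≟ x ⌋ ∧ ⌊ y ≟ y ⌋)
      ≡⟨ cong (λ b → deg G u + χ (⌊ u ≟ x ⌋ ∧ b)) (≟-refl y) ⟩
    deg G u + χ (⌊ u ≟ x ⌋ ∧ true)                              ≡⟨ cong (λ b → deg G u + χ b) (∧-identityʳ _) ⟩
    deg G u + χ ⌊ u ≟ x ⌋                                       ∎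
    where open ≡-Reasoning

  deg-inl-≢ : ∀ {u} → u ≢ x → deg J (inl u) ≡ deg G u
  deg-inl-≢ {u} u≢x = trans (deg-inl u) (trans (cong (λ b → deg G u + χ b) (≟-≢ u≢x)) (+-identityʳ _))

  deg-inl-x : deg J (inl x) ≡ deg G x + 1
  deg-inl-x = trans (deg-inl x) (cong (λ b → deg G x + χ b) (≟-refl x))

  adj-inr-inl : ∀ v u → adj J (inr v) (inl u) ≡ ⌊ u ≟ x ⌋ ∧ ⌊ v ≟ y ⌋
  adj-inr-inl v u = trans (Graph.sym J (inr v) (inl u)) (adj-inl-inr u v)

  module _ {K : Graph} (f : Embedding G K) (g : Embedding H K)
           (disjoint : ∀ u v → vertex f u ≢ vertex g v)
           (cross : ∀ u v → adj K (vertex f u) (vertex g v) ≡ ⌊ u ≟ x ⌋ ∧ ⌊ v ≟ y ⌋) where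

    copair : Fin (n J) → Fin (n K)
    copair w = [ vertex f , vertex g ]′ (splitAt (n G) w)

    copair-inl : ∀ u → copair (inl u) ≡ vertex f u
    copair-inl u = cong [ vertex f , vertex g ]′ (splitAt-↑ˡ (n G) u (n H))

    copair-inr : ∀ v → copair (inr v) ≡ vertex g v
    copair-inr v = cong [ vertex f , vertex g ]′ (splitAt-↑ʳ (n G) (n H) v)

    copair-injective : ∀ {w w′} → copair w ≡ copair w′ → w ≡ w′
    copair-injective {w} {w′} eq with view w | view w′
    ... | isl u | isl u′ = cong inl (Embedding.injective f (trans (≡-sym (copair-inl u)) (trans eq (copair-inl u′))))
    ... | isl u | isr v′ = ⊥-elim (disjoint u v′ (trans (≡-sym (copair-inl u)) (trans eq (copair-inr v′))))
    ... | isr v | isl u′ = ⊥-elim (disjoint u′ v (trans (≡-sym (copair-inl u′)) (trans (≡-sym eq) (copair-inr v))))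
    ... | isr v | isr v′ = cong inr (Embedding.injective g (trans (≡-sym (copair-inr v)) (trans eq (copair-inr v′))))

    copair-adj : ∀ w w′ → adj K (copair w) (copair w′) ≡ adj J w w′
    copair-adj w w′ with view w | view w′
    ... | isl u | isl u′ rewrite copair-inl u | copair-inl u′ =
      trans (Embedding.adj-vertex f u u′) (≡-sym (Embedding.adj-vertex inl-embedding u u′))
    ... | isl u | isr v′ rewrite copair-inl u | copair-inr v′ = trans (cross u v′) (≡-sym (adj-inl-inr u v′))
    ... | isr v | isl u′ rewrite copair-inr v | copair-inl u′ =
      trans (Graph.sym K _ _) (trans (cross u′ v) (≡-sym (adj-inr-inl v u′)))
    ... | isr v | isr v′ rewrite copair-inr v | copair-inr v′ =
      trans (Embedding.adj-vertex g v v′) (≡-sym (Embedding.adj-vertex inr-embedding v v′))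

    join-embedding : Embedding J K
    join-embedding = record { vertex = copair ; injective = copair-injective ; adj-vertex = copair-adj }

    join-iso : (∀ t → InImage f t ⊎ InImage g t) → Iso J K
    join-iso cover = surjective-iso join-embedding onto
      where
      onto : ∀ t → InImage join-embedding t
      onto t with cover t
      ... | inj₁ (u , refl) = inl u , copair-inl u
      ... | inj₂ (v , refl) = inr v , copair-inr v

join-swap : ∀ G H x y → Iso (join H G y x) (join G H x y)
join-swap G H x y = H+G.join-iso G+H.inr-embedding G+H.inl-embedding (λ u v → G+H.inl≢inr ∘ ≡-sym)
  (λ u v → trans (G+H.adj-inr-inl u v) (∧-comm ⌊ v ≟ x ⌋ ⌊ u ≟ y ⌋)) cover
  where
  module G+H = Join G H x y
  module H+G = Join H G y x
  cover : ∀ t → InImage G+H.inr-embedding t ⊎ InImage G+H.inl-embedding t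
  cover t with G+H.view t
  ... | G+H.isl u = inj₂ (u , refl)
  ... | G+H.isr v = inj₁ (v , refl)

join-deg-inr : ∀ G H x y v → deg (join G H x y) (Join.inr G H x y v) ≡ deg H v + χ ⌊ v ≟ y ⌋
join-deg-inr G H x y v = begin
  deg (join G H x y) (G+H.inr v)                          ≡⟨ cong (deg (join G H x y)) (cong [ _ , _ ]′ (splitAt-↑ˡ (n H) v (n G))) ⟨
  deg (join G H x y) (Inverse.to (Iso.bij swap) (H+G.inl v)) ≡⟨ iso-deg swap (H+G.inl v) ⟩
  deg (join H G y x) (H+G.inl v)                          ≡⟨ H+G.deg-inl v ⟩
  deg H v + χ ⌊ v ≟ y ⌋                                   ∎
  where
  open ≡-Reasoning
  module G+H = Join G H x y
  module H+G = Join H G y x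
  swap = join-swap G H x y

join-deg-inr-≢ : ∀ G H x y {v} → v ≢ y → deg (join G H x y) (Join.inr G H x y v) ≡ deg H v
join-deg-inr-≢ G H x y {v} v≢y =
  trans (join-deg-inr G H x y v) (trans (cong (λ b → deg H v + χ b) (≟-≢ v≢y)) (+-identityʳ _))

join-deg-inr-y : ∀ G H x y → deg (join G H x y) (Join.inr G H x y y) ≡ deg H y + 1
join-deg-inr-y G H x y = trans (join-deg-inr G H x y y) (cong (λ b → deg H y + χ b) (≟-refl y))

module _ {G H : Graph} {x : Fin (n G)} {y : Fin (n H)} where
  open Join G H x y

  join-connectedWithin : (Q : Fin (n J) → Set) → Q (inl x) →
    (∀ {u} → Q (inl u) → WalkWithin G (Q ∘ inl) u x) →
    (∀ {v} → Q (inr v) → WalkWithin H (Q ∘ inr) v y) → ConnectedWithin J Q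
  join-connectedWithin Q Qx to-x to-y u v Qu Qv = to-bridge Qu ++ʷ reverseʷ (to-bridge Qv)
    where
    to-bridge : ∀ {w} → Q w → WalkWithin J Q w (inl x)
    to-bridge {w} Qw with view w
    ... | isl u = mapʷ inl-embedding id (to-x Qw)
    ... | isr v = snocʷ (mapʷ inr-embedding id (to-y Qw)) (adj-sym J bridge-adj) Qx

  mutual
    project-walk : ∀ {Q : Fin (n J) → Set} {s t u v} → s ≡ inl u → t ≡ inl v →
      WalkWithin J Q s t → WalkWithin G (Q ∘ inl) u v
    project-walk refl t≡v (stop q) rewrite Embedding.injective inl-embedding t≡v = stop q
    project-walk {u = u} refl t≡v (move {v = w} q e rest) with view w
    ... | isl u′ = move q (trans (≡-sym (Embedding.adj-vertex inl-embedding u u′)) e) (project-walk refl t≡v rest)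
    ... | isr v′ with bridge e
    ...   | refl , refl = project-walk-from-right refl t≡v rest

    project-walk-from-right : ∀ {Q : Fin (n J) → Set} {s t r v} → s ≡ inr r → t ≡ inl v →
      WalkWithin J Q s t → WalkWithin G (Q ∘ inl) x v
    project-walk-from-right refl t≡v (stop q) = ⊥-elim (inl≢inr (≡-sym t≡v))
    project-walk-from-right refl t≡v (move {v = w} q e rest) with view w
    ... | isr v′ = project-walk-from-right refl t≡v rest
    ... | isl u′ with bridge (adj-sym J e)
    ...   | refl , refl = project-walk refl t≡v rest

-- Reachable sets and a parity argument

module Reachable (G : Graph) (P : Fin (n G) → Bool) (a : Fin (n G)) (Pa : P a ≡ true) where
  Allowed : Fin (n G) → Set
  Allowed u = P u ≡ true

  Closed : (Fin (n G) → Bool) → Set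
  Closed K = ∀ {u w} → K u ≡ true → adj G u w ≡ true → Allowed w → K w ≡ true

  grow : (Fin (n G) → Bool) → Fin (n G) → Bool
  grow R u = R u ∨ (P u ∧ ⌊ any? (λ w → T? (R w ∧ adj G w u)) ⌋)

  reached : ℕ → Fin (n G) → Bool
  reached zero    u = ⌊ u ≟ a ⌋
  reached (suc k) = grow (reached k)

  grow-⊇ : ∀ {R} → R ⊆ᵇ grow R
  grow-⊇ Ru rewrite Ru = refl

  reached-a : ∀ k → reached k a ≡ true
  reached-a zero    = ≟-refl a
  reached-a (suc k) = grow-⊇ (reached-a k)

  reached-walk : ∀ k {u} → reached k u ≡ true → WalkWithin G Allowed a u
  reached-walk zero    ru rewrite ≟-true ru = stop Pa
  reached-walk (suc k) {u} ru with reached k u in rk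
  ... | true  = reached-walk k rk
  ... | false with ∧-true ru
  ...   | Pu , found with toWitness {a? = any? (λ w → T? (reached k w ∧ adj G w u))} (Equivalence.from T-≡ found)
  ...     | w , Tw with ∧-true (Equivalence.to T-≡ Tw)
  ...       | rw , wu = snocʷ (reached-walk k rw) wu Pu

  stable⇒closed : ∀ {R} → (∀ u → grow R u ≡ R u) → Closed R
  stable⇒closed {R} stable {u} {w} Ru uw Pw = begin
    R w                                                 ≡⟨ stable w ⟨
    R w ∨ (P w ∧ ⌊ any? (λ z → T? (R z ∧ adj G z w)) ⌋) ≡⟨ cong (λ b → R w ∨ (P w ∧ b)) found ⟩
    R w ∨ (P w ∧ true)                                  ≡⟨ cong (λ b → R w ∨ (b ∧ true)) Pw ⟩
    R w ∨ true                                          ≡⟨ ∨-zeroʳ (R w) ⟩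
    true                                                ∎
    where
    open ≡-Reasoning
    found : ⌊ any? (λ z → T? (R z ∧ adj G z w)) ⌋ ≡ true
    found = Equivalence.to T-≡ (fromWitness (u , Equivalence.from T-≡ (cong₂ _∧_ Ru uw)))

  stabilises : ∀ k → (∃[ j ] ∀ u → grow (reached j) u ≡ reached j u) ⊎ k < count (reached k)
  stabilises zero = inj₂ (count-positive (reached zero) (reached-a zero))
  stabilises (suc k) with stabilises k
  ... | inj₁ stable = inj₁ stable
  ... | inj₂ k<count with count-strict {R = reached k} grow-⊇
  ...   | inj₁ stable = inj₁ (k , stable)
  ...   | inj₂ count< = inj₂ (≤-trans (s≤s k<count) count<)

  component : ∃[ K ] K a ≡ true × Closed K × (∀ {u} → K u ≡ true → WalkWithin G Allowed a u)
  component with stabilises (n G)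
  ... | inj₁ (j , stable) = reached j , reached-a j , stable⇒closed stable , reached-walk j
  ... | inj₂ n<count      = ⊥-elim (<⇒≱ n<count (count-≤ (reached (n G))))

module _ (G : Graph) (K : Fin (n G) → Bool) {v : Fin (n G)} (Kv : K v ≡ false)
         (closed : ∀ {u w} → K u ≡ true → adj G u w ≡ true → w ≢ v → K w ≡ true) where

  closed-deg : ∀ u → χ (K u) * deg G u ≡ count (λ w → K u ∧ (K w ∧ adj G u w)) + χ (K u ∧ adj G u v)
  closed-deg u with K u in Ku
  ... | false = ≡-sym (cong (_+ 0) (∑-zero {n G} _ (λ _ → refl)))
  ... | true  = begin
    deg G u + 0                                                 ≡⟨ +-identityʳ _ ⟩
    deg G u                                                     ≡⟨ deg≡count G u ⟩
    count (adj G u)                                             ≡⟨ sum-cong-≗ split ⟩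
    ∑[ w < n G ] (χ (K w ∧ adj G u w) + χ (not (K w) ∧ adj G u w)) ≡⟨ ∑-distrib-+ {n G} _ _ ⟩
    count (λ w → K w ∧ adj G u w) + ∑[ w < n G ] χ (not (K w) ∧ adj G u w)
      ≡⟨ cong (count (λ w → K w ∧ adj G u w) +_) (∑-single _ v only-v) ⟩
    count (λ w → K w ∧ adj G u w) + χ (not (K v) ∧ adj G u v)
      ≡⟨ cong (λ b → count (λ w → K w ∧ adj G u w) + χ (not b ∧ adj G u v)) Kv ⟩
    count (λ w → K w ∧ adj G u w) + χ (adj G u v)                ∎
    where
    open ≡-Reasoning
    split : ∀ w → χ (adj G u w) ≡ χ (K w ∧ adj G u w) + χ (not (K w) ∧ adj G u w)
    split w with K w | adj G u w
    ... | true  | true  = refl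
    ... | true  | false = refl
    ... | false | true  = refl
    ... | false | false = refl
    only-v : ∀ w → w ≢ v → χ (not (K w) ∧ adj G u w) ≡ 0
    only-v w w≢v with adj G u w in uw
    ... | false = cong χ (∧-zeroʳ _)
    ... | true rewrite closed Ku uw w≢v = refl

  private
    inside-sym : ∀ u w → K u ∧ (K w ∧ adj G u w) ≡ K w ∧ (K u ∧ adj G w u)
    inside-sym u w rewrite Graph.sym G u w with K u | K w
    ... | true  | true  = refl
    ... | true  | false = refl
    ... | false | true  = refl
    ... | false | false = refl

    inside-irrefl : ∀ u → K u ∧ (K u ∧ adj G u u) ≡ false
    inside-irrefl u rewrite irrefl G u = trans (cong (K u ∧_) (∧-zeroʳ (K u))) (∧-zeroʳ (K u))

  closed-deg-sum : ∃[ e ] ∑[ u < n G ] (χ (K u) * deg G u) ≡ (e + e) + count (λ u → K u ∧ adj G u v)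
  closed-deg-sum with handshake-even (λ u w → K u ∧ (K w ∧ adj G u w)) inside-sym inside-irrefl
  ... | e , inside≡e+e = e , trans (sum-cong-≗ closed-deg)
    (trans (∑-distrib-+ {n G} _ _) (cong (_+ count (λ u → K u ∧ adj G u v)) inside≡e+e))

-- Circles

module Circle (C : Graph) (isC : IsCircle C) (v : Fin (n C)) where
  private
    neighbours = deg≡2⇒neighbours C v (proj₂ isC v)

  a b : Fin (n C)
  a = proj₁ neighbours
  b = proj₁ (proj₂ neighbours)

  a≢b : a ≢ b
  a≢b = proj₁ (proj₂ (proj₂ neighbours))

  va : adj C v a ≡ true
  va = proj₁ (proj₂ (proj₂ (proj₂ neighbours)))

  vb : adj C v b ≡ true
  vb = proj₁ (proj₂ (proj₂ (proj₂ (proj₂ neighbours))))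

  only-ab : ∀ w → adj C v w ≡ true → w ≡ a ⊎ w ≡ b
  only-ab = proj₂ (proj₂ (proj₂ (proj₂ (proj₂ neighbours))))

  Avoid : Fin (n C) → Set
  Avoid u = u ≢ v

  -- If the component K of a in C − v missed b, the only edge leaving K would be a—v,
  -- making the degree sum 2|K| over K odd.
  walk-a-b : WalkWithin C Avoid a b
  walk-a-b with Reachable.component C (λ u → not ⌊ u ≟ v ⌋) a (≢⇒≟-false (adj⇒≢ C va ∘ ≡-sym))
  ... | K , Ka , closed , walk with K b in Kb
  ...   | true  = weakenʷ ≟-false⇒≢ (walk Kb)
  ...   | false = ⊥-elim (double≢odd (count K) e (begin
          count K * 2                                   ≡⟨ *-distribʳ-sum 2 (χ ∘ K) ⟩
          ∑[ u < n C ] (χ (K u) * 2)                    ≡⟨ sum-cong-≗ (λ u → cong (χ (K u) *_) (proj₂ isC u)) ⟨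
          ∑[ u < n C ] (χ (K u) * deg C u)              ≡⟨ degsum ⟩
          (e + e) + count (λ u → K u ∧ adj C u v)       ≡⟨ cong ((e + e) +_) one-neighbour ⟩
          (e + e) + 1                                   ∎))
    where
    open ≡-Reasoning
    Kv : K v ≡ false
    Kv with K v in Kv
    ... | false = refl
    ... | true  = ⊥-elim (≟-false⇒≢ (target-within (walk Kv)) refl)
    closed-avoiding : ∀ {u w} → K u ≡ true → adj C u w ≡ true → w ≢ v → K w ≡ true
    closed-avoiding Ku uw w≢v = closed Ku uw (≢⇒≟-false w≢v)
    e = proj₁ (closed-deg-sum C K Kv closed-avoiding)
    degsum = proj₂ (closed-deg-sum C K Kv closed-avoiding)
    one-neighbour : count (λ u → K u ∧ adj C u v) ≡ 1
    one-neighbour = trans (∑-single _ a only-a) (cong₂ (λ p q → χ (p ∧ q)) Ka (adj-sym C va))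
      where
      only-a : ∀ u → u ≢ a → χ (K u ∧ adj C u v) ≡ 0
      only-a u u≢a with adj C u v in uv
      ... | false = cong χ (∧-zeroʳ (K u))
      ... | true with only-ab u (adj-sym C uv)
      ...   | inj₁ u≡a  = ⊥-elim (u≢a u≡a)
      ...   | inj₂ refl rewrite Kb = refl

  onCycle : OnCycle C v
  onCycle = a , b , a≢b , va , vb , weakenʷ (tt ,_) walk-a-b

  private
    to-a : ∀ {w} → w ≢ v → Walk C w v → WalkWithin C Avoid w a
    to-a w≢v here = ⊥-elim (w≢v refl)
    to-a {w} w≢v (step {v = w′} e rest) with w′ ≟ v
    ... | no w′≢v  = move w≢v e (to-a w′≢v rest)
    ... | yes refl with only-ab w (adj-sym C e)
    ...   | inj₁ refl = stop w≢v
    ...   | inj₂ refl = reverseʷ walk-a-b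

  connected-without : ConnectedWithin C Avoid
  connected-without u w u≢v w≢v = to-a u≢v (walk u v) ++ʷ reverseʷ (to-a w≢v (walk w v))
    where walk = proj₂ (proj₁ isC)

-- Constructed circle-trees

OffCycleVertexWithout : (G : Graph) → Fin (n G) → Set
OffCycleVertexWithout G x = ∃[ w ] w ≢ x × ¬ OnCycleWithin G (_≢ x) w

deg≡2-neighbour-offCycle : ∀ G {t x} → deg G t ≡ 2 → adj G t x ≡ true → OffCycleVertexWithout G x
deg≡2-neighbour-offCycle G {t} {x} d tx = t , adj⇒≢ G tx , λ (α , β , α≢β , tα , tβ , walk) →
  two-neighbours α≢β (proj₁ (source-within walk)) (proj₁ (target-within walk))
    (only-pq x tx) (only-pq α tα) (only-pq β tβ)
  where
  nbrs = deg≡2⇒neighbours G t d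
  p = proj₁ nbrs
  q = proj₁ (proj₂ nbrs)
  only-pq = proj₂ (proj₂ (proj₂ (proj₂ (proj₂ nbrs))))
  two-neighbours : ∀ {α β} → α ≢ β → α ≢ x → β ≢ x →
    x ≡ p ⊎ x ≡ q → α ≡ p ⊎ α ≡ q → β ≡ p ⊎ β ≡ q → ⊥
  two-neighbours α≢β α≢x β≢x (inj₁ refl) (inj₁ refl) _           = α≢x refl
  two-neighbours α≢β α≢x β≢x (inj₁ refl) (inj₂ refl) (inj₁ refl) = β≢x refl
  two-neighbours α≢β α≢x β≢x (inj₁ refl) (inj₂ refl) (inj₂ refl) = α≢β refl
  two-neighbours α≢β α≢x β≢x (inj₂ refl) (inj₂ refl) _           = α≢x refl
  two-neighbours α≢β α≢x β≢x (inj₂ refl) (inj₁ refl) (inj₂ refl) = β≢x refl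
  two-neighbours α≢β α≢x β≢x (inj₂ refl) (inj₁ refl) (inj₁ refl) = α≢β refl

built-connected : ∀ {G} → BuildsCircleTree G → Connected G
built-connected (base isC) = proj₁ isC
built-connected (glue {G} {C} bG isC x′ y′ _ _ _) with built-connected bG
... | 0<n , walk = ≤-trans 0<n (m≤m+n _ _) , λ u v →
  toWalk (join-connectedWithin (λ _ → ⊤) tt (λ _ → fromWalk (walk _ x′)) (λ _ → fromWalk (proj₂ (proj₁ isC) _ y′))
    u v tt tt)

built-deg≤3 : ∀ {G} → BuildsCircleTree G → ∀ v → deg G v ≤ 3
built-deg≤3 (base isC) v rewrite proj₂ isC v = s≤s (s≤s z≤n)
built-deg≤3 (glue {G} {C} bG isC x′ y′ deg≤3 dx dy) w with Join.view G C x′ y′ w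
... | Join.isl u with u ≟ x′
...   | yes refl rewrite Join.deg-inl-x G C x′ y′ | dx = ≤-refl
...   | no u≢x′  rewrite Join.deg-inl-≢ G C x′ y′ u≢x′ = deg≤3 u
built-deg≤3 (glue {G} {C} bG isC x′ y′ deg≤3 dx dy) w | Join.isr v with v ≟ y′
...   | yes refl rewrite join-deg-inr-y G C x′ y′ | dy = ≤-refl
...   | no v≢y′  rewrite join-deg-inr-≢ G C x′ y′ v≢y′ | proj₂ isC v = s≤s (s≤s z≤n)

built-onCycle : ∀ {G} → BuildsCircleTree G → ∀ w → OnCycle G w
built-onCycle (base {C} isC) = Circle.onCycle C isC
built-onCycle (glue {G} {C} bG isC x′ y′ _ _ _) w with Join.view G C x′ y′ w
... | Join.isl u = onCycle-map (Join.inl-embedding G C x′ y′) id (built-onCycle bG u)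
... | Join.isr v = onCycle-map (Join.inr-embedding G C x′ y′) id (Circle.onCycle C isC v)

built-connected-without : ∀ {G} → BuildsCircleTree G → ∀ {x} → deg G x ≡ 2 → ConnectedWithin G (_≢ x)
built-connected-without (base {C} isC) _ = Circle.connected-without C isC _
built-connected-without (glue {G} {C} bG isC x′ y′ _ dx _) {x} d with Join.view G C x′ y′ x
... | Join.isl u with u ≟ x′
...   | yes refl = ⊥-elim (≡2⇒+1≢2 dx (trans (≡-sym (Join.deg-inl-x G C x′ y′)) d))
...   | no u≢x′  = join-connectedWithin _ (u≢x′ ∘ ≡-sym ∘ inl-injective)
        (λ p≢u → weakenʷ (λ z≢u → z≢u ∘ inl-injective) (IH _ x′ (p≢u ∘ cong inl) (u≢x′ ∘ ≡-sym)))
        (λ _ → weakenʷ (λ _ → inl≢inr ∘ ≡-sym) (fromWalk (proj₂ (proj₁ isC) _ y′)))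
  where
  open Join G C x′ y′
  inl-injective = Embedding.injective inl-embedding
  IH = built-connected-without bG (trans (≡-sym (deg-inl-≢ u≢x′)) d)
built-connected-without (glue {G} {C} bG isC x′ y′ _ _ dy) {x} d | Join.isr v with v ≟ y′
...   | yes refl = ⊥-elim (≡2⇒+1≢2 dy (trans (≡-sym (join-deg-inr-y G C x′ y′)) d))
...   | no v≢y′  = join-connectedWithin _ inl≢inr
        (λ _ → weakenʷ (λ _ → inl≢inr) (fromWalk (proj₂ (built-connected bG) _ x′)))
        (λ q≢v → weakenʷ (λ z≢v → z≢v ∘ inr-injective)
                   (Circle.connected-without C isC v _ y′ (q≢v ∘ cong inr) (v≢y′ ∘ ≡-sym)))
  where
  open Join G C x′ y′
  inr-injective = Embedding.injective inr-embedding

built-offCycle : ∀ {G} → BuildsCircleTree G → ∀ {x} → deg G x ≡ 2 → OffCycleVertexWithout G x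
built-offCycle (base {C} isC) {x} _ = deg≡2-neighbour-offCycle C (proj₂ isC _) (adj-sym C (Circle.va C isC x))
built-offCycle (glue {G} {C} bG isC x′ y′ _ _ dy) {x} d with Join.view G C x′ y′ x
built-offCycle (glue {G} {C} bG isC x′ y′ _ _ dy) d | Join.isr v with v ≟ y′
... | yes refl = ⊥-elim (≡2⇒+1≢2 dy (trans (≡-sym (join-deg-inr-y G C x′ y′)) d))
... | no v≢y′ with Circle.a C isC v ≟ y′
...   | no a≢y′ = deg≡2-neighbour-offCycle (join G C x′ y′)
          (trans (join-deg-inr-≢ G C x′ y′ a≢y′) (proj₂ isC _))
          (Embedding.adj-true (Join.inr-embedding G C x′ y′) (adj-sym C (Circle.va C isC v)))
...   | yes a≡y′ = deg≡2-neighbour-offCycle (join G C x′ y′)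
          (trans (join-deg-inr-≢ G C x′ y′ (λ b≡y′ → Circle.a≢b C isC v (trans a≡y′ (≡-sym b≡y′)))) (proj₂ isC _))
          (Embedding.adj-true (Join.inr-embedding G C x′ y′) (adj-sym C (Circle.vb C isC v)))
built-offCycle (glue {G} {C} bG isC x′ y′ _ dx _) d | Join.isl u with u ≟ x′
... | yes refl = ⊥-elim (≡2⇒+1≢2 dx (trans (≡-sym (Join.deg-inl-x G C x′ y′)) d))
... | no u≢x′ with built-offCycle bG (trans (≡-sym (Join.deg-inl-≢ G C x′ y′ u≢x′)) d)
...   | w , w≢u , off = inl w , w≢u ∘ inl-injective , onCycle
  where
  open Join G C x′ y′
  inl-injective = Embedding.injective inl-embedding
  -- A cycle through inl w leaving G must return over the bridge, i.e. through inl x′ = inl w.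
  onCycle : ¬ OnCycleWithin J (_≢ inl u) (inl w)
  onCycle (α , β , α≢β , wα , wβ , walk) with view α | view β
  ... | isl α′ | isl β′ = off (α′ , β′ , α≢β ∘ cong inl ,
          trans (≡-sym (Embedding.adj-vertex inl-embedding w α′)) wα ,
          trans (≡-sym (Embedding.adj-vertex inl-embedding w β′)) wβ ,
          weakenʷ (Data.Product.map (_∘ cong inl) (_∘ cong inl)) (project-walk refl refl walk))
  ... | isr α′ | isr β′ with bridge wα | bridge wβ
  ...   | _ , refl | _ , refl = α≢β refl
  onCycle (α , β , α≢β , wα , wβ , walk) | isr α′ | isl β′ with bridge wα
  ...   | refl , _ = proj₂ (source-within (project-walk-from-right refl refl walk)) refl
  onCycle (α , β , α≢β , wα , wβ , walk) | isl α′ | isr β′ with bridge wβ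
  ...   | refl , _ = proj₂ (source-within (project-walk-from-right refl refl (reverseʷ walk))) refl

-- Splitting at a vertex of degree 3

-- T ≅ A +_{a,b} B for constructed circle-trees A and B, presented by the embeddings of the two sides.
record Glued (T : Graph) : Set where
  field
    A B      : Graph
    a        : Fin (n A)
    b        : Fin (n B)
    A-builds : BuildsCircleTree A
    B-builds : BuildsCircleTree B
    deg-a    : deg A a ≡ 2
    deg-b    : deg B b ≡ 2
    left     : Embedding A T
    right    : Embedding B T
    disjoint : ∀ p q → vertex left p ≢ vertex right q
    cover    : ∀ t → InImage left t ⊎ InImage right t
    cross    : ∀ p q → adj T (vertex left p) (vertex right q) ≡ ⌊ p ≟ a ⌋ ∧ ⌊ q ≟ b ⌋

  glued : Iso (join A B a b) T
  glued = Join.join-iso A B a b left right disjoint cross cover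

  deg-left : ∀ p → deg T (vertex left p) ≡ deg A p + χ ⌊ p ≟ a ⌋
  deg-left p = begin
    deg T (vertex left p)                                  ≡⟨ cong (deg T) (Join.copair-inl A B a b left right disjoint cross p) ⟨
    deg T (Inverse.to (Iso.bij glued) (Join.inl A B a b p)) ≡⟨ iso-deg glued _ ⟩
    deg (join A B a b) (Join.inl A B a b p)                ≡⟨ Join.deg-inl A B a b p ⟩
    deg A p + χ ⌊ p ≟ a ⌋                                  ∎
    where open ≡-Reasoning

SplitAt : (T : Graph) → Fin (n T) → Set
SplitAt T x = Σ[ S ∈ Glued T ] vertex (Glued.left S) (Glued.a S) ≡ x

glued-swap : ∀ {T} → Glued T → Glued T
glued-swap {T} S = record
  { A = B ; B = A ; a = b ; b = a ; A-builds = B-builds ; B-builds = A-builds ; deg-a = deg-b ; deg-b = deg-a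
  ; left = right ; right = left
  ; disjoint = λ q p → disjoint p q ∘ ≡-sym
  ; cover = Data.Sum.swap ∘ cover
  ; cross = λ q p → trans (Graph.sym T _ _) (trans (cross p q) (∧-comm ⌊ p ≟ a ⌋ ⌊ q ≟ b ⌋))
  }
  where open Glued S

glued-iso : ∀ {T T′} → Iso T T′ → Glued T → Glued T′
glued-iso {T} {T′} I S = record
  { A = A ; B = B ; a = a ; b = b ; A-builds = A-builds ; B-builds = B-builds ; deg-a = deg-a ; deg-b = deg-b
  ; left = f ∘ᵉ left ; right = f ∘ᵉ right
  ; disjoint = λ p q → disjoint p q ∘ Embedding.injective f
  ; cover = cover′
  ; cross = λ p q → trans (Embedding.adj-vertex f _ _) (cross p q)
  }
  where
  open Glued S
  f = iso-embedding I
  cover′ : ∀ t → InImage (f ∘ᵉ left) t ⊎ InImage (f ∘ᵉ right) t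
  cover′ t with iso-surjective I t
  ... | s , refl with cover s
  ...   | inj₁ (p , refl) = inj₁ (p , refl)
  ...   | inj₂ (q , refl) = inj₂ (q , refl)

join-glued : ∀ {G C} → BuildsCircleTree G → BuildsCircleTree C → ∀ {x y} → deg G x ≡ 2 → deg C y ≡ 2 →
  SplitAt (join G C x y) (Join.inl G C x y x)
join-glued {G} {C} bG bC {x} {y} dx dy = record
  { A = G ; B = C ; a = x ; b = y ; A-builds = bG ; B-builds = bC ; deg-a = dx ; deg-b = dy
  ; left = inl-embedding ; right = inr-embedding
  ; disjoint = λ _ _ → inl≢inr
  ; cover = cover
  ; cross = adj-inl-inr
  } , refl
  where
  open Join G C x y
  cover : ∀ t → InImage inl-embedding t ⊎ InImage inr-embedding t
  cover t with view t
  ... | isl u = inj₁ (u , refl)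
  ... | isr v = inj₂ (v , refl)

module Extendˡ {G : Graph} (S : Glued G) {C : Graph} (isC : IsCircle C) {x : Fin (n G)} {y : Fin (n C)}
               (dx : deg G x ≡ 2) (dy : deg C y ≡ 2) {p} (left-p : vertex (Glued.left S) p ≡ x) where
  open Glued S
  module T = Join G C x y
  module A′ = Join A C p y

  a≢p : a ≢ p
  a≢p refl = ≡2⇒+1≢2 deg-a (begin
    deg A a + 1              ≡⟨ cong (λ b → deg A a + χ b) (≟-refl a) ⟨
    deg A a + χ ⌊ a ≟ a ⌋    ≡⟨ deg-left a ⟨
    deg G (vertex left a)    ≡⟨ cong (deg G) left-p ⟩
    deg G x                  ≡⟨ dx ⟩
    2                        ∎)
    where open ≡-Reasoning

  deg-p : deg A p ≡ 2
  deg-p = begin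
    deg A p                      ≡⟨ +-identityʳ _ ⟨
    deg A p + χ false            ≡⟨ cong (λ b → deg A p + χ b) (≟-≢ (a≢p ∘ ≡-sym)) ⟨
    deg A p + χ ⌊ p ≟ a ⌋        ≡⟨ deg-left p ⟨
    deg G (vertex left p)        ≡⟨ cong (deg G) left-p ⟩
    deg G x                      ≡⟨ dx ⟩
    2                            ∎
    where open ≡-Reasoning

  private
    cross-C : ∀ s c → adj T.J (T.inl (vertex left s)) (T.inr c) ≡ ⌊ s ≟ p ⌋ ∧ ⌊ c ≟ y ⌋
    cross-C s c = trans (T.adj-inl-inr _ c)
      (cong (_∧ ⌊ c ≟ y ⌋) (trans (cong (λ z → ⌊ vertex left s ≟ z ⌋) (≡-sym left-p))
                                 (≟-injective (vertex left) (Embedding.injective left) s p)))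

  left′ : Embedding A′.J T.J
  left′ = A′.join-embedding (T.inl-embedding ∘ᵉ left) T.inr-embedding (λ _ _ → T.inl≢inr) cross-C

  left′-inl : ∀ s → vertex left′ (A′.inl s) ≡ T.inl (vertex left s)
  left′-inl = A′.copair-inl (T.inl-embedding ∘ᵉ left) T.inr-embedding (λ _ _ → T.inl≢inr) cross-C

  left′-inr : ∀ c → vertex left′ (A′.inr c) ≡ T.inr c
  left′-inr = A′.copair-inr (T.inl-embedding ∘ᵉ left) T.inr-embedding (λ _ _ → T.inl≢inr) cross-C

  private
    T-inl-injective = Embedding.injective T.inl-embedding

    disjoint′ : ∀ w q → vertex left′ w ≢ T.inl (vertex right q)
    disjoint′ w q with A′.view w
    ... | A′.isl s rewrite left′-inl s = disjoint s q ∘ T-inl-injective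
    ... | A′.isr c rewrite left′-inr c = T.inl≢inr ∘ ≡-sym

    cover′ : ∀ t → InImage left′ t ⊎ InImage (T.inl-embedding ∘ᵉ right) t
    cover′ t with T.view t
    ... | T.isr c = inj₁ (A′.inr c , left′-inr c)
    ... | T.isl g with cover g
    ...   | inj₁ (s , refl) = inj₁ (A′.inl s , left′-inl s)
    ...   | inj₂ (q , refl) = inj₂ (q , refl)

    cross′ : ∀ w q → adj T.J (vertex left′ w) (T.inl (vertex right q)) ≡ ⌊ w ≟ A′.inl a ⌋ ∧ ⌊ q ≟ b ⌋
    cross′ w q with A′.view w
    ... | A′.isl s rewrite left′-inl s =
      trans (Embedding.adj-vertex T.inl-embedding _ _)
        (trans (cross s q) (cong (_∧ ⌊ q ≟ b ⌋) (≡-sym (≟-injective A′.inl (Embedding.injective A′.inl-embedding) s a))))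
    ... | A′.isr c rewrite left′-inr c =
      trans (T.adj-inr-inl c _)
        (trans (cong (_∧ ⌊ c ≟ y ⌋) (≟-≢ (λ eq → disjoint p q (trans left-p (≡-sym eq)))))
          (≡-sym (cong (_∧ ⌊ q ≟ b ⌋) (≟-≢ (A′.inl≢inr ∘ ≡-sym)))))

  extended : Glued T.J
  extended = record
    { A = A′.J ; B = B ; a = A′.inl a ; b = b
    ; A-builds = glue A-builds isC p y (built-deg≤3 A-builds) deg-p dy ; B-builds = B-builds
    ; deg-a = trans (A′.deg-inl-≢ a≢p) deg-a ; deg-b = deg-b
    ; left = left′ ; right = T.inl-embedding ∘ᵉ right
    ; disjoint = disjoint′ ; cover = cover′ ; cross = cross′
    }

built-split : ∀ {T} → BuildsCircleTree T → ∀ {x} → deg T x ≡ 3 → SplitAt T x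
built-split (base isC) {x} d with trans (≡-sym (proj₂ isC x)) d
... | ()
built-split (glue {G} {C} bG isC x′ y′ _ dx dy) {x} d with Join.view G C x′ y′ x
built-split (glue {G} {C} bG isC x′ y′ _ dx dy) d | Join.isr v with v ≟ y′
... | yes refl = glued-swap (proj₁ (join-glued bG (base isC) dx dy)) , refl
... | no v≢y′ with trans (≡-sym (trans (join-deg-inr-≢ G C x′ y′ v≢y′) (proj₂ isC v))) d
...   | ()
built-split (glue {G} {C} bG isC x′ y′ _ dx dy) d | Join.isl u with u ≟ x′
... | yes refl = join-glued bG (base isC) dx dy
... | no u≢x′ with built-split bG (trans (≡-sym (Join.deg-inl-≢ G C x′ y′ u≢x′)) d)
...   | S , left-a with Glued.cover S x′
...     | inj₁ (p , left-p) = Extendˡ.extended S isC dx dy left-p ,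
          trans (Extendˡ.left′-inl S isC dx dy left-p _) (cong (Join.inl G C x′ y′) left-a)
...     | inj₂ (q , right-q) = glued-swap (Extendˡ.extended (glued-swap S) isC dx dy right-q) ,
          cong (Join.inl G C x′ y′) left-a

-- Deleting a vertex of a circle-tree

module _ {T : Graph} (ct : IsCircleTree T) where
  private
    G  = proj₁ ct
    bG = proj₁ (proj₂ ct)
    I  = proj₂ (proj₂ ct)
    f  = iso-embedding I

    deg-from : ∀ {x′ k} → deg T (vertex f x′) ≡ k → deg G x′ ≡ k
    deg-from {x′} d = trans (≡-sym (iso-deg I x′)) d

  circleTree-onCycle : ∀ w → OnCycle T w
  circleTree-onCycle w with iso-surjective I w
  ... | w′ , refl = onCycle-map f id (built-onCycle bG w′)

  circleTree-connected-without : ∀ {x} → deg T x ≡ 2 → ConnectedWithin T (_≢ x)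
  circleTree-connected-without {x} d u v with iso-surjective I x | iso-surjective I u | iso-surjective I v
  ... | x′ , refl | u′ , refl | v′ , refl = λ u≢x v≢x →
    mapʷ f (_∘ Embedding.injective f)
      (built-connected-without bG (deg-from d) u′ v′ (u≢x ∘ cong (vertex f)) (v≢x ∘ cong (vertex f)))

  circleTree-offCycle : ∀ {x} → deg T x ≡ 2 → OffCycleVertexWithout T x
  circleTree-offCycle {x} d with iso-surjective I x
  ... | x′ , refl with built-offCycle bG (deg-from d)
  ...   | w , w≢x′ , off = vertex f w , w≢x′ ∘ Embedding.injective f ,
          off ∘ onCycle-weaken (_∘ cong (vertex f)) ∘ onCycle-pull f (λ {t} _ → iso-surjective I t)

  circleTree-split : ∀ {x} → deg T x ≡ 3 → SplitAt T x
  circleTree-split {x} d with iso-surjective I x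
  ... | x′ , refl with built-split bG (deg-from d)
  ...   | S , left-a = glued-iso I S , cong (vertex f) left-a

module _ (G : Graph) (x : Fin (n G)) where
  private
    P : Fin (n G) → Bool
    P v = not ⌊ v ≟ x ⌋
    ℓ = induced-embedding G P

  delete-connected : ConnectedWithin G (_≢ x) → ∀ {u} → u ≢ x → Connected (delete G x)
  delete-connected conn u≢x = induced-connected G P
    (λ u v u≠x v≠x → weakenʷ ≢⇒≟-false (conn u v (≟-false⇒≢ u≠x) (≟-false⇒≢ v≠x))) (≢⇒≟-false u≢x)

  delete-not-circleTree : OffCycleVertexWithout G x → ¬ IsCircleTree (delete G x)
  delete-not-circleTree (w , w≢x , off) ct with induced-onto G P (≢⇒≟-false w≢x)
  ... | i , refl = off (onCycle-map ℓ (λ {u} _ → ≟-false⇒≢ (induced-holds G P u)) (circleTree-onCycle ct i))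

deg≡2-case : ∀ {T} → IsCircleTree T → ∀ {x} → deg T x ≡ 2 →
  Connected (delete T x) × ¬ IsCircleTree (delete T x)
deg≡2-case {T} ct {x} d with deg≡2⇒neighbours T x d
... | a , _ , _ , xa , _ =
  delete-connected T x (circleTree-connected-without ct d) (adj⇒≢ T xa ∘ ≡-sym) ,
  delete-not-circleTree T x (circleTree-offCycle ct d)

module Components {T : Graph} (S : Glued T) {x : Fin (n T)} (left-a : vertex (Glued.left S) (Glued.a S) ≡ x) where
  open Glued S

  D : Graph
  D = delete T x

  private
    Px : Fin (n T) → Bool
    Px v = not ⌊ v ≟ x ⌋
    ℓ = induced-embedding T Px

  on-right : Fin (n T) → Bool
  on-right t = [ (λ _ → false) , (λ _ → true) ]′ (cover t)

  on-right-left : ∀ p → on-right (vertex left p) ≡ false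
  on-right-left p with cover (vertex left p)
  ... | inj₁ _        = refl
  ... | inj₂ (q , eq) = ⊥-elim (disjoint p q (≡-sym eq))

  on-right-right : ∀ q → on-right (vertex right q) ≡ true
  on-right-right q with cover (vertex right q)
  ... | inj₁ (p , eq) = ⊥-elim (disjoint p q eq)
  ... | inj₂ _        = refl

  on-right-false : ∀ {t} → on-right t ≡ false → InImage left t
  on-right-false {t} _ with cover t
  on-right-false () | inj₂ _
  ... | inj₁ image = image

  on-right-true : ∀ {t} → on-right t ≡ true → InImage right t
  on-right-true {t} _ with cover t
  on-right-true () | inj₁ _
  ... | inj₂ image = image

  left≢x : ∀ {p} → p ≢ a → vertex left p ≢ x
  left≢x p≢a eq = p≢a (Embedding.injective left (trans eq (≡-sym left-a)))

  right≢x : ∀ q → vertex right q ≢ x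
  right≢x q eq = disjoint a q (trans left-a (≡-sym eq))

  c : Fin (n D) → Bool
  c = on-right ∘ vertex ℓ

  no-cross-edge : ∀ {i j p q} → vertex left p ≡ vertex ℓ i → vertex right q ≡ vertex ℓ j → adj D i j ≢ true
  no-cross-edge {i} {j} {p} {q} pi qj ij with ∧-true (trans (≡-sym (cross p q)) (trans (cong₂ (adj T) pi qj) ij))
  ... | p≟a , _ = ≟-false⇒≢ (induced-holds T Px i) (trans (≡-sym pi) (trans (cong (vertex left) (≟-true p≟a)) left-a))

  c-respects-adj : ∀ i j → adj D i j ≡ true → c i ≡ c j
  c-respects-adj i j ij with on-right (vertex ℓ i) in ri | on-right (vertex ℓ j) in rj
  ... | false | false = refl
  ... | true  | true  = refl
  ... | false | true  = ⊥-elim (no-cross-edge (proj₂ (on-right-false ri)) (proj₂ (on-right-true rj)) ij)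
  ... | true  | false = ⊥-elim (no-cross-edge (proj₂ (on-right-false rj)) (proj₂ (on-right-true ri)) (adj-sym D ij))

  not-connected : ¬ Connected D
  not-connected (_ , walk) with deg≡2⇒neighbours A a deg-a
  ... | p , _ , _ , ap , _ with induced-onto T Px (≢⇒≟-false (left≢x (adj⇒≢ A ap ∘ ≡-sym)))
                              | induced-onto T Px (≢⇒≟-false (right≢x b))
  ...   | i , ℓi≡left | j , ℓj≡right with walk-invariant c c-respects-adj (walk i j)
  ...     | ci≡cj with trans (≡-sym (trans (cong on-right ℓi≡left) (on-right-left p)))
                             (trans ci≡cj (trans (cong on-right ℓj≡right) (on-right-right b)))
  ...       | ()

  right-component : Iso B (Induced D c)
  right-component = induced-iso D c (restrict T Px right right-allowed)
    (λ q → trans (cong on-right (restrict-vertex T Px right right-allowed q)) (on-right-right q))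
    (λ ci → restrict-onto T Px right right-allowed (on-right-true ci))
    where
    right-allowed : ∀ q → Px (vertex right q) ≡ true
    right-allowed = ≢⇒≟-false ∘ right≢x

  left-component : Iso (delete A a) (Induced D (not ∘ c))
  left-component = induced-iso D (not ∘ c) (restrict T Px eA eA-allowed)
    (λ k → cong not (trans (cong on-right (restrict-vertex T Px eA eA-allowed k)) (on-right-left _)))
    onto
    where
    Pa : Fin (n A) → Bool
    Pa v = not ⌊ v ≟ a ⌋
    eA = left ∘ᵉ induced-embedding A Pa
    eA-allowed : ∀ k → Px (vertex eA k) ≡ true
    eA-allowed k = ≢⇒≟-false (left≢x (≟-false⇒≢ (induced-holds A Pa k)))
    onto : ∀ {i} → not (c i) ≡ true → InImage (restrict T Px eA eA-allowed) i
    onto {i} nci with on-right-false (trans (≡-sym (not-involutive _)) (cong not nci))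
    ... | p , left-p
      with induced-onto A Pa (≢⇒≟-false λ { refl → ≟-false⇒≢ (induced-holds T Px i) (trans (≡-sym left-p) left-a) })
    ...   | k , ℓAk≡p = restrict-onto T Px eA eA-allowed (k , trans (cong (vertex left) ℓAk≡p) left-p)

  split-components : ¬ Connected D × TwoComponentsExactlyOneCircleTree D
  split-components with deg≡2-case (A , A-builds , iso-refl) deg-a
  ... | A-a-connected , A-a-not-circleTree =
    not-connected , c ,
    iso-connected right-component (built-connected B-builds) ,
    iso-connected left-component A-a-connected ,
    c-respects-adj ,
    inj₁ ((B , B-builds , right-component) , A-a-not-circleTree ∘ λ ct → circleTree-iso ct (iso-sym left-component))

deg≡3-case : ∀ {T} → IsCircleTree T → ∀ {x} → deg T x ≡ 3 →
  ¬ Connected (delete T x) × TwoComponentsExactlyOneCircleTree (delete T x)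
deg≡3-case ct d with circleTree-split ct d
... | S , left-a = Components.split-components S left-a

lemma4p15 : (T : Graph) → IsCircleTree T → (x : Fin (n T)) →
    (deg T x ≡ 2 → Connected (delete T x) × ¬ IsCircleTree (delete T x)) ×
    (deg T x ≡ 3 → ¬ Connected (delete T x) × TwoComponentsExactlyOneCircleTree (delete T x))
lemma4p15 T ct x = deg≡2-case ct , deg≡3-case ct
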